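{- Let $m\geq 2$ and let $q\geq 3$ be a prime power. If $f\in R_q((m-1)(q-1)+q-3,m)$ satisfies $|f|=4$, or if $f\in R_q((m-1)(q-1)+q-2,m)$ satisfies $|f|=3$, then the support of $f$ is contained in an affine plane of $\mathbb{F}_q^m$.
   Context: $\mathbb{F}_q$ is the finite field with $q$ elements and $B_m^q$ is the $\mathbb{F}_q$-algebra of all functions $\mathbb{F}_q^m\to\mathbb{F}_q$. Every $f\in B_m^q$ is given by a unique polynomial in $\mathbb{F}_q[X_1,\ldots,X_m]$ of degree at most $q-1$ in each variable (its reduced form), and $\deg(f)$ is the total degree of this reduced form. For $0\leq r\leq m(q-1)$, $R_q(r,m)=\{f\in B_m^q:\deg(f)\leq r\}$ is the generalized Reed–Muller code. The support of $f$ is $\{x\in\mathbb{F}_q^m: f(x)\neq 0\}$ and $|f|$ denotes its cardinality. -}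

module Defs where

open import Level using (0ℓ)
open import Data.Nat as ℕ using (ℕ; zero; suc)
open import Data.Nat.Primality using (Prime)
open import Data.Fin as Fin using (Fin; toℕ)
open import Data.Vec as Vec using (Vec; []; _∷_)
open import Data.List as List using (List; []; _∷_; length; filter; concatMap; map; foldr)
open import Data.Product using (Σ; ∃; ∃-syntax; _×_; _,_)
open import Relation.Nullary using (¬_; ¬?; Dec; yes; no)
open import Relation.Binary.PropositionalEquality using (_≡_; _≢_)
open import Algebra.Structures using (IsCommutativeRing)

IsPrimePower : ℕ → Set
IsPrimePower q = ∃[ p ] ∃[ k ] (Prime p × q ≡ p ℕ.^ suc k)

record FiniteField (q : ℕ) : Set₁ where
  field
    Carrier : Set
    _+_ _*_ : Carrier → Carrier → Carrier
    -_      : Carrier → Carrier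
    0# 1#   : Carrier
    isCommutativeRing : IsCommutativeRing _≡_ _+_ _*_ -_ 0# 1#
    0≢1     : 0# ≢ 1#
    inverse : ∀ x → x ≢ 0# → ∃[ y ] (x * y ≡ 1#)
    _≟_     : (x y : Carrier) → Dec (x ≡ y)
    enum    : Fin q → Carrier
    enum-injective  : ∀ i j → enum i ≡ enum j → i ≡ j
    enum-surjective : ∀ x → ∃[ i ] (enum i ≡ x)

  infixl 6 _+_
  infixl 7 _*_

  _^_ : Carrier → ℕ → Carrier
  x ^ zero  = 1#
  x ^ suc n = x * (x ^ n)

  sumL : List Carrier → Carrier
  sumL = foldr _+_ 0#

  elements : List Carrier
  elements = map enum (List.allFin q)

  Point : ℕ → Set
  Point m = Vec Carrier m

  allPoints : (m : ℕ) → List (Point m)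
  allPoints zero    = [] ∷ []
  allPoints (suc m) = concatMap (λ a → map (a ∷_) (allPoints m)) elements

  B : ℕ → Set
  B m = Point m → Carrier

  -- exponent vectors of reduced monomials: each exponent in {0,…,q-1}
  Exponent : ℕ → Set
  Exponent m = Vec (Fin q) m

  allExponents : (m : ℕ) → List (Exponent m)
  allExponents zero    = [] ∷ []
  allExponents (suc m) = concatMap (λ i → map (i ∷_) (allExponents m)) (List.allFin q)

  totalDegree : ∀ {m} → Exponent m → ℕ
  totalDegree []       = 0
  totalDegree (e ∷ es) = toℕ e ℕ.+ totalDegree es

  monomial : ∀ {m} → Exponent m → Point m → Carrier
  monomial []       []       = 1#
  monomial (e ∷ es) (x ∷ xs) = (x ^ toℕ e) * monomial es xs

  ReducedPoly : ℕ → Set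
  ReducedPoly m = Exponent m → Carrier

  eval : ∀ {m} → ReducedPoly m → Point m → Carrier
  eval {m} c x = sumL (map (λ e → c e * monomial e x) (allExponents m))

  DegreeAtMost : ∀ {m} → ℕ → ReducedPoly m → Set
  DegreeAtMost r c = ∀ e → c e ≢ 0# → totalDegree e ℕ.≤ r

  -- f ∈ R_q(r,m): the reduced form of f (the unique reduced polynomial
  -- representing f) has total degree ≤ r.
  InRM : (r m : ℕ) → B m → Set
  InRM r m f = Σ (ReducedPoly m) λ c → (∀ x → eval c x ≡ f x) × DegreeAtMost r c

  InSupport : ∀ {m} → B m → Point m → Set
  InSupport f x = f x ≢ 0#

  weight : ∀ {m} → B m → ℕ
  weight {m} f = length (filter (λ x → ¬? (f x ≟ 0#)) (allPoints m))

  _⊕_ : ∀ {m} → Point m → Point m → Point m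
  _⊕_ = Vec.zipWith _+_

  _⊙_ : ∀ {m} → Carrier → Point m → Point m
  a ⊙ v = Vec.map (a *_) v

  zeroV : ∀ {m} → Point m
  zeroV = Vec.replicate _ 0#

  LinearlyIndependent₂ : ∀ {m} → Point m → Point m → Set
  LinearlyIndependent₂ u v = ∀ a b → (a ⊙ u) ⊕ (b ⊙ v) ≡ zeroV → (a ≡ 0#) × (b ≡ 0#)

  InPlane : ∀ {m} → Point m → Point m → Point m → Point m → Set
  InPlane p u v x = ∃[ s ] ∃[ t ] (x ≡ p ⊕ ((s ⊙ u) ⊕ (t ⊙ v)))

  SupportInAffinePlane : ∀ {m} → B m → Set
  SupportInAffinePlane {m} f =
    ∃[ p ] ∃[ u ] ∃[ v ] (LinearlyIndependent₂ {m} u v ×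
      (∀ x → InSupport f x → InPlane p u v x))

{-# OPTIONS --safe #-}
-- Let r = (m-1)(q-1) + q-3. Summing f against a monomial of degree at most m(q-1) - r - 1 over
-- F_q^m gives 0, because some exponent is then below q-1 and Σ_a a^k = 0 for k < q-1. In particular
-- f is orthogonal to 1 and to every coordinate function, so the values λᵢ of f at its four
-- support points Pᵢ satisfy Σ λᵢ = 0 and Σ λᵢ Pᵢ = 0: the points are affinely dependent, hence
-- coplanar.
module Submission where

open import Level using (0ℓ)
open import Function using (_∘_)
open import Relation.Binary.PropositionalEquality
open import Relation.Nullary using (¬_; ¬?; Dec; yes; no)
open import Relation.Nullary.Decidable using (decidable-stable)
open import Data.Empty using (⊥-elim)
open import Data.Product using (∃-syntax; _×_; _,_; proj₁; proj₂)
open import Data.Nat as ℕ using (ℕ; zero; suc; _<_; _≤_; z≤n; s≤s)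
open import Data.Nat.Properties as ℕₚ using ()
open import Data.Fin as Fin using (Fin; toℕ)
open import Data.Fin.Properties using (any?)
open import Data.Fin.Permutation using (Permutation; permutation; _⟨$⟩ʳ_)
open import Data.Vec as Vec using (Vec; []; _∷_)
open import Data.Vec.Properties
  using (lookup-zipWith; lookup-map; lookup-replicate; lookup∘tabulate; tabulate∘lookup; tabulate-cong)
open import Data.Vec.Relation.Unary.Any using (Any; here; there)
open import Data.List as List using (List; []; _∷_; length; concatMap; map; filter; _++_)
open import Data.List.Properties using (length-map; length-tabulate; map-∘)
open import Data.List.Membership.Propositional using (_∈_)
open import Data.List.Membership.Propositional.Properties using (∈-map⁺; ∈-concatMap⁺; ∈-filter⁺; ∈-allFin)
import Data.List.Relation.Unary.Any as Any
open import Data.List.Relation.Unary.All as All using (All; []; _∷_)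
open import Data.List.Relation.Unary.All.Properties using (all-filter)
open import Data.List.Relation.Unary.AllPairs using ([]; _∷_)
open import Data.List.Relation.Unary.Unique.Propositional using (Unique)
import Data.List.Relation.Unary.Unique.Propositional.Properties as Unique
open import Algebra.Bundles using (CommutativeRing; CommutativeMonoid)
open import Algebra.Structures using (IsCommutativeRing)
import Algebra.Properties.CommutativeMonoid.Sum as FinSum
open import Algebra.Properties.CommutativeSemigroup ℕₚ.+-commutativeSemigroup
  using () renaming (interchange to ℕ-interchange)

open import Defs

module FieldProperties {q : ℕ} (F : FiniteField q) where
  open FiniteField F public
  open IsCommutativeRing isCommutativeRing public
    using (+-assoc; +-comm; +-identityˡ; +-identityʳ; -‿inverseˡ; -‿inverseʳ;
           *-assoc; *-comm; *-identityˡ; *-identityʳ; distribˡ; distribʳ; zeroˡ; zeroʳ)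

  commutativeRing : CommutativeRing 0ℓ 0ℓ
  commutativeRing = record { isCommutativeRing = isCommutativeRing }

  open CommutativeRing commutativeRing using (commutativeSemiring; ring; +-abelianGroup; +-commutativeMonoid)
  open import Algebra.Properties.Ring ring public using (-‿distribˡ-*)
  open import Algebra.Properties.AbelianGroup +-abelianGroup public
    using () renaming (∙-cancelˡ to +-cancelˡ; ∙-cancelʳ to +-cancelʳ; inverseʳ-unique to +-inverseʳ-unique;
                       x∙y⁻¹≈ε⇒x≈y to x-y≡0⇒x≡y; ⁻¹-∙-comm to -‿+-comm; xyx⁻¹≈y to x+y-x≡y)
  open import Algebra.Properties.CommutativeSemigroup (CommutativeMonoid.commutativeSemigroup +-commutativeMonoid) public
    using () renaming (interchange to +-interchange)
  open import Algebra.Solver.Ring.NaturalCoefficients.Default commutativeSemiring public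
    using (solve; _:=_; _:+_; _:*_; con)

  *-cancelʳ-nonzero : ∀ z {x y} → z ≢ 0# → x * z ≡ y * z → x ≡ y
  *-cancelʳ-nonzero z {x} {y} z≢0 xz≡yz with inverse z z≢0
  ... | w , zw≡1 = begin
      x            ≡⟨ sym (*-identityʳ x) ⟩
      x * 1#       ≡⟨ cong (x *_) (sym zw≡1) ⟩
      x * (z * w)  ≡⟨ sym (*-assoc x z w) ⟩
      x * z * w    ≡⟨ cong (_* w) xz≡yz ⟩
      y * z * w    ≡⟨ *-assoc y z w ⟩
      y * (z * w)  ≡⟨ cong (y *_) zw≡1 ⟩
      y * 1#       ≡⟨ *-identityʳ y ⟩
      y            ∎
    where open ≡-Reasoning

  *-cancelˡ-nonzero : ∀ z {x y} → z ≢ 0# → z * x ≡ z * y → x ≡ y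
  *-cancelˡ-nonzero z z≢0 zx≡zy = *-cancelʳ-nonzero z z≢0 (trans (*-comm _ z) (trans zx≡zy (*-comm z _)))

  x*y≡0⇒x≡0 : ∀ {x y} → y ≢ 0# → x * y ≡ 0# → x ≡ 0#
  x*y≡0⇒x≡0 {x} {y} y≢0 xy≡0 = *-cancelʳ-nonzero y y≢0 (trans xy≡0 (sym (zeroˡ y)))

  x≡0⇒x*y≡0 : ∀ {x} y → x ≡ 0# → x * y ≡ 0#
  x≡0⇒x*y≡0 y refl = zeroˡ y

  ^-distrib-* : ∀ x y k → (x * y) ^ k ≡ x ^ k * y ^ k
  ^-distrib-* x y zero = sym (*-identityʳ 1#)
  ^-distrib-* x y (suc k) = begin
      x * y * (x * y) ^ k      ≡⟨ cong (x * y *_) (^-distrib-* x y k) ⟩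
      x * y * (x ^ k * y ^ k)  ≡⟨ solve 4 (λ x y a b → x :* y :* (a :* b) := x :* a :* (y :* b)) refl x y (x ^ k) (y ^ k) ⟩
      x * x ^ k * (y * y ^ k)  ∎
    where open ≡-Reasoning

  ^-distribˡ-+-* : ∀ x m n → x ^ (m ℕ.+ n) ≡ x ^ m * x ^ n
  ^-distribˡ-+-* x zero n = sym (*-identityˡ _)
  ^-distribˡ-+-* x (suc m) n = trans (cong (x *_) (^-distribˡ-+-* x m n)) (sym (*-assoc x _ _))

  module _ {A : Set} where
    sumL-cong : ∀ {f g : A → Carrier} → (∀ a → f a ≡ g a) → ∀ xs → sumL (map f xs) ≡ sumL (map g xs)
    sumL-cong f≗g [] = refl
    sumL-cong f≗g (x ∷ xs) = cong₂ _+_ (f≗g x) (sumL-cong f≗g xs)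

    sumL-≡0 : ∀ {f : A → Carrier} → (∀ a → f a ≡ 0#) → ∀ xs → sumL (map f xs) ≡ 0#
    sumL-≡0 f≡0 [] = refl
    sumL-≡0 f≡0 (x ∷ xs) = trans (cong₂ _+_ (f≡0 x) (sumL-≡0 f≡0 xs)) (+-identityʳ 0#)

    sumL-+ : ∀ (f g : A → Carrier) xs →
      sumL (map (λ a → f a + g a) xs) ≡ sumL (map f xs) + sumL (map g xs)
    sumL-+ f g [] = sym (+-identityʳ 0#)
    sumL-+ f g (x ∷ xs) rewrite sumL-+ f g xs = +-interchange (f x) (g x) _ _

    sumL-*ˡ : ∀ c (f : A → Carrier) xs → sumL (map (λ a → c * f a) xs) ≡ c * sumL (map f xs)
    sumL-*ˡ c f [] = sym (zeroʳ c)
    sumL-*ˡ c f (x ∷ xs) rewrite sumL-*ˡ c f xs = sym (distribˡ c (f x) _)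

    sumL-*ʳ : ∀ c (f : A → Carrier) xs → sumL (map (λ a → f a * c) xs) ≡ sumL (map f xs) * c
    sumL-*ʳ c f [] = sym (zeroˡ c)
    sumL-*ʳ c f (x ∷ xs) rewrite sumL-*ʳ c f xs = sym (distribʳ c (f x) _)

    sumL-++ : ∀ (f : A → Carrier) xs ys → sumL (map f (xs ++ ys)) ≡ sumL (map f xs) + sumL (map f ys)
    sumL-++ f [] ys = sym (+-identityˡ _)
    sumL-++ f (x ∷ xs) ys rewrite sumL-++ f xs ys = sym (+-assoc (f x) _ _)

  sumL-concatMap : ∀ {A B : Set} (h : B → Carrier) (g : A → List B) xs →
    sumL (map h (concatMap g xs)) ≡ sumL (map (λ a → sumL (map h (g a))) xs)
  sumL-concatMap h g [] = refl
  sumL-concatMap h g (x ∷ xs) =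
    trans (sumL-++ h (g x) (concatMap g xs)) (cong (sumL (map h (g x)) +_) (sumL-concatMap h g xs))

  sumL-comm : ∀ {A B : Set} (T : A → B → Carrier) xs ys →
    sumL (map (λ y → sumL (map (λ x → T x y) xs)) ys) ≡ sumL (map (λ x → sumL (map (T x) ys)) xs)
  sumL-comm T xs [] = sym (sumL-≡0 (λ _ → refl) xs)
  sumL-comm T xs (y ∷ ys) =
    trans (cong (sumL (map (λ x → T x y) xs) +_) (sumL-comm T xs ys))
          (sym (sumL-+ (λ x → T x y) (λ x → sumL (map (T x) ys)) xs))

  elements-unique : Unique elements
  elements-unique = Unique.map⁺ (enum-injective _ _) (Unique.allFin⁺ q)

  length-elements : length elements ≡ q
  length-elements = trans (length-map enum (List.allFin q)) (length-tabulate (λ i → i))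

  index : Carrier → Fin q
  index x = proj₁ (enum-surjective x)

  enum-index : ∀ x → enum (index x) ≡ x
  enum-index x = proj₂ (enum-surjective x)

  index-enum : ∀ i → index (enum i) ≡ i
  index-enum i = enum-injective _ _ (enum-index (enum i))

  module FS = FinSum +-commutativeMonoid

  sumL-elements≡sum : ∀ {n} (t : Fin n → Fin q) (h : Carrier → Carrier) →
    sumL (map h (map enum (List.tabulate t))) ≡ FS.sum (h ∘ enum ∘ t)
  sumL-elements≡sum {zero} t h = refl
  sumL-elements≡sum {suc n} t h = cong (h (enum (t Fin.zero)) +_) (sumL-elements≡sum (t ∘ Fin.suc) h)

  sumL-elements-reindex : (σ τ : Carrier → Carrier) → (∀ x → σ (τ x) ≡ x) → (∀ x → τ (σ x) ≡ x) →
    (h : Carrier → Carrier) → sumL (map (h ∘ σ) elements) ≡ sumL (map h elements)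
  sumL-elements-reindex σ τ στ τσ h = begin
      sumL (map (h ∘ σ) elements)          ≡⟨ sumL-elements≡sum (λ i → i) (h ∘ σ) ⟩
      FS.sum (h ∘ σ ∘ enum)                ≡⟨ FS.sum-cong-≗ (λ i → cong h (sym (enum-index (σ (enum i))))) ⟩
      FS.sum (h ∘ enum ∘ (π ⟨$⟩ʳ_))        ≡⟨ sym (FS.sum-permute (h ∘ enum) π) ⟩
      FS.sum (h ∘ enum)                    ≡⟨ sym (sumL-elements≡sum (λ i → i) h) ⟩
      sumL (map h elements)                ∎
    where
      open ≡-Reasoning
      conjugate : (Carrier → Carrier) → Fin q → Fin q
      conjugate ρ = index ∘ ρ ∘ enum
      inverse-conjugate : ∀ ρ ρ′ → (∀ x → ρ (ρ′ x) ≡ x) → ∀ i → conjugate ρ (conjugate ρ′ i) ≡ i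
      inverse-conjugate ρ ρ′ ρρ′ i =
        trans (cong (index ∘ ρ) (enum-index _)) (trans (cong index (ρρ′ _)) (index-enum i))
      π : Permutation q q
      π = permutation (conjugate σ) (conjugate τ) (inverse-conjugate σ τ στ) (inverse-conjugate τ σ τσ)

  -- A monic polynomial function of degree d, in Horner form.
  IsMonic : ℕ → (Carrier → Carrier) → Set
  IsMonic zero h = ∀ x → h x ≡ 1#
  IsMonic (suc d) h = ∃[ c ] ∃[ h′ ] IsMonic d h′ × (∀ x → h x ≡ c + x * h′ x)

  ^-isMonic : ∀ k → IsMonic k (_^ k)
  ^-isMonic zero = λ _ → refl
  ^-isMonic (suc k) = 0# , _ , ^-isMonic k , λ x → sym (+-identityˡ _)

  monic-divide : ∀ d {h} → IsMonic (suc d) h → ∀ b →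
    ∃[ g ] IsMonic d g × ∃[ r ] (∀ x → h x ≡ (x + b) * g x + r)
  monic-divide zero {h} (c , h′ , h′≡1 , h≡) b = (λ _ → 1#) , (λ _ → refl) , c + - b , λ x → begin
      h x                         ≡⟨ h≡ x ⟩
      c + x * h′ x                ≡⟨ cong (λ y → c + x * y) (h′≡1 x) ⟩
      c + x * 1#                  ≡⟨ sym (+-identityʳ _) ⟩
      c + x * 1# + 0#             ≡⟨ cong (c + x * 1# +_) (sym (-‿inverseʳ b)) ⟩
      c + x * 1# + (b + - b)      ≡⟨ solve 4 (λ x b c b′ → c :+ x :* con 1 :+ (b :+ b′) := (x :+ b) :* con 1 :+ (c :+ b′)) refl x b c (- b) ⟩
      (x + b) * 1# + (c + - b)    ∎
    where open ≡-Reasoning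
  monic-divide (suc d) {h} (c , h′ , h′-monic , h≡) b with monic-divide d h′-monic b
  ... | g , g-monic , r , h′≡ = (λ x → r + x * g x) , (r , g , g-monic , λ _ → refl) , c + - (b * r) , λ x → begin
      h x                                                   ≡⟨ h≡ x ⟩
      c + x * h′ x                                          ≡⟨ cong (λ y → c + x * y) (h′≡ x) ⟩
      c + x * ((x + b) * g x + r)                           ≡⟨ sym (+-identityʳ _) ⟩
      c + x * ((x + b) * g x + r) + 0#                      ≡⟨ cong (c + x * ((x + b) * g x + r) +_) (sym (-‿inverseʳ (b * r))) ⟩
      c + x * ((x + b) * g x + r) + (b * r + - (b * r))
        ≡⟨ solve 6 (λ x b c r G n → c :+ x :* ((x :+ b) :* G :+ r) :+ (b :* r :+ n) := (x :+ b) :* (r :+ x :* G) :+ (c :+ n))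
             refl x b c r (g x) (- (b * r)) ⟩
      (x + b) * (r + x * g x) + (c + - (b * r))             ∎
    where open ≡-Reasoning

  monic-factor : ∀ d {h} → IsMonic (suc d) h → ∀ a → h a ≡ 0# →
    ∃[ g ] IsMonic d g × (∀ x → h x ≡ (x + - a) * g x)
  monic-factor d {h} h-monic a ha≡0 with monic-divide d h-monic (- a)
  ... | g , g-monic , r , h≡ = g , g-monic , λ x → trans (h≡ x) (trans (cong (_ +_) r≡0) (+-identityʳ _))
    where
      r≡0 : r ≡ 0#
      r≡0 = begin
          r                         ≡⟨ sym (+-identityˡ r) ⟩
          0# + r                    ≡⟨ cong (_+ r) (sym (zeroˡ (g a))) ⟩
          0# * g a + r              ≡⟨ cong (λ y → y * g a + r) (sym (-‿inverseʳ a)) ⟩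
          (a + - a) * g a + r       ≡⟨ sym (h≡ a) ⟩
          h a                       ≡⟨ ha≡0 ⟩
          0#                        ∎
        where open ≡-Reasoning

  monic-roots-bound : ∀ d {h} → IsMonic d h → ∀ xs → Unique xs → All (λ a → h a ≡ 0#) xs → length xs ≤ d
  monic-roots-bound d h-monic [] _ _ = z≤n
  monic-roots-bound zero h≡1 (a ∷ _) _ (ha≡0 ∷ _) = ⊥-elim (0≢1 (trans (sym ha≡0) (h≡1 a)))
  monic-roots-bound (suc d) {h} h-monic (a ∷ xs) (a∉xs ∷ xs-unique) (ha≡0 ∷ hxs≡0)
    with monic-factor d h-monic a ha≡0
  ... | g , g-monic , h≡ = s≤s (monic-roots-bound d g-monic xs xs-unique (roots-of-g a∉xs hxs≡0))
    where
      roots-of-g : ∀ {ys} → All (a ≢_) ys → All (λ b → h b ≡ 0#) ys → All (λ b → g b ≡ 0#) ys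
      roots-of-g [] [] = []
      roots-of-g {b ∷ _} (a≢b ∷ a≢ys) (hb≡0 ∷ hys≡0) =
        x*y≡0⇒x≡0 (λ b-a≡0 → a≢b (sym (x-y≡0⇒x≡y b a b-a≡0))) (trans (*-comm _ _) (trans (sym (h≡ b)) hb≡0))
        ∷ roots-of-g a≢ys hys≡0

  powerSum : ℕ → Carrier
  powerSum k = sumL (map (_^ k) elements)

  -- Translating by 1 permutes the field, so Σ (a + 1) = Σ a, i.e. q · 1 = 0.
  powerSum-0 : powerSum 0 ≡ 0#
  powerSum-0 = +-cancelˡ S (powerSum 0) 0# (begin
      S + powerSum 0                        ≡⟨ sym (sumL-+ (λ a → a) (λ _ → 1#) elements) ⟩
      sumL (map (λ a → a + 1#) elements)    ≡⟨ sumL-elements-reindex (_+ 1#) (_+ - 1#) (cancel (-‿inverseˡ 1#)) (cancel (-‿inverseʳ 1#)) (λ a → a) ⟩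
      S                                     ≡⟨ sym (+-identityʳ S) ⟩
      S + 0#                                ∎)
    where
      open ≡-Reasoning
      S = sumL (map (λ a → a) elements)
      cancel : ∀ {b c} → b + c ≡ 0# → ∀ x → x + b + c ≡ x
      cancel b+c≡0 x = trans (+-assoc x _ _) (trans (cong (x +_) b+c≡0) (+-identityʳ x))

  powerSum-scale : ∀ k {c} → c ≢ 0# → c ^ k * powerSum k ≡ powerSum k
  powerSum-scale k {c} c≢0 with inverse c c≢0
  ... | w , cw≡1 = begin
      c ^ k * powerSum k                         ≡⟨ sym (sumL-*ˡ (c ^ k) (_^ k) elements) ⟩
      sumL (map (λ a → c ^ k * a ^ k) elements)  ≡⟨ sumL-cong (λ a → sym (^-distrib-* c a k)) elements ⟩
      sumL (map (λ a → (c * a) ^ k) elements)    ≡⟨ sumL-elements-reindex (c *_) (w *_) (cancel cw≡1) (cancel (trans (*-comm w c) cw≡1)) (_^ k) ⟩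
      powerSum k                                 ∎
    where
      open ≡-Reasoning
      cancel : ∀ {b b′} → b * b′ ≡ 1# → ∀ x → b * (b′ * x) ≡ x
      cancel bb′≡1 x = trans (sym (*-assoc _ _ x)) (trans (cong (_* x) bb′≡1) (*-identityˡ x))

  -- If the sum were nonzero, every nonzero x would satisfy x^k = 1,
  -- so the monic polynomial x (x^k - 1) of degree k + 1 < q would vanish on the whole field.
  powerSum≡0 : ∀ k → k < q ℕ.∸ 1 → powerSum k ≡ 0#
  powerSum≡0 zero _ = powerSum-0
  powerSum≡0 k@(suc k′) k<q-1 with powerSum k ≟ 0#
  ... | yes sum≡0 = sum≡0
  ... | no sum≢0 = ⊥-elim (ℕₚ.<⇒≱ k<q-1 (ℕₚ.∸-monoˡ-≤ 1 q≤k+1))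
    where
      h : Carrier → Carrier
      h x = x * (x ^ k + - 1#)
      h-monic : IsMonic (suc k) h
      h-monic = 0# , _ , (- 1# , _ , ^-isMonic k′ , λ _ → +-comm _ _) , λ _ → sym (+-identityˡ _)
      x^k≡1 : ∀ {x} → x ≢ 0# → x ^ k ≡ 1#
      x^k≡1 x≢0 = *-cancelʳ-nonzero (powerSum k) sum≢0 (trans (powerSum-scale k x≢0) (sym (*-identityˡ _)))
      h≡0 : ∀ x → h x ≡ 0#
      h≡0 x with x ≟ 0#
      ... | yes refl = zeroˡ _
      ... | no x≢0 = trans (cong (λ y → x * (y + - 1#)) (x^k≡1 x≢0)) (trans (cong (x *_) (-‿inverseʳ 1#)) (zeroʳ x))
      q≤k+1 : q ≤ suc k
      q≤k+1 = subst (_≤ suc k) length-elements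
        (monic-roots-bound (suc k) h-monic elements elements-unique (All.tabulate (λ {x} _ → h≡0 x)))

module MonomialSums {q : ℕ} (F : FiniteField q) where
  open FieldProperties F

  sumPoints : ∀ m → (Point m → Carrier) → Carrier
  sumPoints m h = sumL (map h (allPoints m))

  sumPoints-∷ : ∀ m (h : Point (suc m) → Carrier) →
    sumPoints (suc m) h ≡ sumL (map (λ a → sumPoints m (h ∘ (a ∷_))) elements)
  sumPoints-∷ m h = trans (sumL-concatMap h (λ a → map (a ∷_) (allPoints m)) elements)
    (sumL-cong (λ a → cong sumL (sym (map-∘ (allPoints m)))) elements)

  monomialℕ : ∀ {m} → Vec ℕ m → Point m → Carrier
  monomialℕ [] [] = 1#
  monomialℕ (n ∷ ns) (x ∷ xs) = x ^ n * monomialℕ ns xs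

  sumPoints-monomialℕ≡0 : ∀ {m} (ns : Vec ℕ m) → Any (_< q ℕ.∸ 1) ns → sumPoints m (monomialℕ ns) ≡ 0#
  sumPoints-monomialℕ≡0 {suc m} (n ∷ ns) some-n<q-1 = begin
      sumPoints (suc m) (monomialℕ (n ∷ ns))                  ≡⟨ sumPoints-∷ m (monomialℕ (n ∷ ns)) ⟩
      sumL (map (λ a → sumPoints m (λ xs → a ^ n * monomialℕ ns xs)) elements)
        ≡⟨ sumL-cong (λ a → sumL-*ˡ (a ^ n) (monomialℕ ns) (allPoints m)) elements ⟩
      sumL (map (λ a → a ^ n * sumPoints m (monomialℕ ns)) elements)
        ≡⟨ sumL-*ʳ (sumPoints m (monomialℕ ns)) (_^ n) elements ⟩
      powerSum n * sumPoints m (monomialℕ ns)                 ≡⟨ factor≡0 some-n<q-1 ⟩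
      0#                                                      ∎
    where
      open ≡-Reasoning
      factor≡0 : Any (_< q ℕ.∸ 1) (n ∷ ns) → powerSum n * sumPoints m (monomialℕ ns) ≡ 0#
      factor≡0 (here n<q-1) = x≡0⇒x*y≡0 _ (powerSum≡0 n n<q-1)
      factor≡0 (there some-n<q-1) = trans (cong (powerSum n *_) (sumPoints-monomialℕ≡0 ns some-n<q-1)) (zeroʳ _)

  monomialℕ-zipWith : ∀ {m} (ms ns : Vec ℕ m) x →
    monomialℕ (Vec.zipWith ℕ._+_ ms ns) x ≡ monomialℕ ms x * monomialℕ ns x
  monomialℕ-zipWith [] [] [] = sym (*-identityˡ 1#)
  monomialℕ-zipWith (m ∷ ms) (n ∷ ns) (x ∷ xs) = begin
      x ^ (m ℕ.+ n) * monomialℕ (Vec.zipWith ℕ._+_ ms ns) xs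
        ≡⟨ cong₂ _*_ (^-distribˡ-+-* x m n) (monomialℕ-zipWith ms ns xs) ⟩
      x ^ m * x ^ n * (monomialℕ ms xs * monomialℕ ns xs)
        ≡⟨ solve 4 (λ a b c d → a :* b :* (c :* d) := a :* c :* (b :* d)) refl (x ^ m) (x ^ n) _ _ ⟩
      x ^ m * monomialℕ ms xs * (x ^ n * monomialℕ ns xs)        ∎
    where open ≡-Reasoning

  monomial≡monomialℕ : ∀ {m} (e : Exponent m) x → monomial e x ≡ monomialℕ (Vec.map toℕ e) x
  monomial≡monomialℕ [] [] = refl
  monomial≡monomialℕ (e ∷ es) (x ∷ xs) = cong (x ^ toℕ e *_) (monomial≡monomialℕ es xs)

  sum-map-toℕ : ∀ {m} (e : Exponent m) → Vec.sum (Vec.map toℕ e) ≡ totalDegree e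
  sum-map-toℕ [] = refl
  sum-map-toℕ (e ∷ es) = cong (toℕ e ℕ.+_) (sum-map-toℕ es)

  sum-zipWith-+ : ∀ {m} (ms ns : Vec ℕ m) → Vec.sum (Vec.zipWith ℕ._+_ ms ns) ≡ Vec.sum ms ℕ.+ Vec.sum ns
  sum-zipWith-+ [] [] = refl
  sum-zipWith-+ (m ∷ ms) (n ∷ ns) rewrite sum-zipWith-+ ms ns = ℕ-interchange m n (Vec.sum ms) (Vec.sum ns)

  sum<m*D⇒Any<D : ∀ D {m} (ns : Vec ℕ m) → Vec.sum ns < m ℕ.* D → Any (_< D) ns
  sum<m*D⇒Any<D D (n ∷ ns) sum<m*D with n ℕₚ.<? D
  ... | yes n<D = here n<D
  ... | no n≮D = there (sum<m*D⇒Any<D D ns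
    (ℕₚ.+-cancelˡ-< D _ _ (ℕₚ.≤-<-trans (ℕₚ.+-monoˡ-≤ (Vec.sum ns) (ℕₚ.≮⇒≥ n≮D)) sum<m*D)))

  sumPoints-monomial-*-monomialℕ≡0 : ∀ {m} (e : Exponent m) (ns : Vec ℕ m) →
    totalDegree e ℕ.+ Vec.sum ns < m ℕ.* (q ℕ.∸ 1) → sumPoints m (λ x → monomial e x * monomialℕ ns x) ≡ 0#
  sumPoints-monomial-*-monomialℕ≡0 {m} e ns degree< = begin
      sumPoints m (λ x → monomial e x * monomialℕ ns x)  ≡⟨ sumL-cong product (allPoints m) ⟩
      sumPoints m (monomialℕ ns′)                        ≡⟨ sumPoints-monomialℕ≡0 ns′ (sum<m*D⇒Any<D (q ℕ.∸ 1) ns′ degree′<) ⟩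
      0#                                                 ∎
    where
      open ≡-Reasoning
      ns′ = Vec.zipWith ℕ._+_ (Vec.map toℕ e) ns
      product : ∀ x → monomial e x * monomialℕ ns x ≡ monomialℕ ns′ x
      product x = trans (cong (_* monomialℕ ns x) (monomial≡monomialℕ e x)) (sym (monomialℕ-zipWith (Vec.map toℕ e) ns x))
      degree′< : Vec.sum ns′ < m ℕ.* (q ℕ.∸ 1)
      degree′< = subst (_< m ℕ.* (q ℕ.∸ 1))
        (sym (trans (sum-zipWith-+ (Vec.map toℕ e) ns) (cong (ℕ._+ Vec.sum ns) (sum-map-toℕ e)))) degree<

  sumPoints-*-monomialℕ≡0 : ∀ {m r} {f : B m} → InRM r m f → (ns : Vec ℕ m) →
    r ℕ.+ Vec.sum ns < m ℕ.* (q ℕ.∸ 1) → sumPoints m (λ x → f x * monomialℕ ns x) ≡ 0#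
  sumPoints-*-monomialℕ≡0 {m} {r} {f} (c , eval≡f , deg≤r) ns bound = begin
      sumL (map (λ x → f x * g x) X)                         ≡⟨ sumL-cong (λ x → cong (_* g x) (sym (eval≡f x))) X ⟩
      sumL (map (λ x → eval c x * g x) X)                    ≡⟨ sumL-cong (λ x → sym (sumL-*ʳ (g x) (λ e → c e * monomial e x) E)) X ⟩
      sumL (map (λ x → sumL (map (λ e → c e * monomial e x * g x) E)) X)
        ≡⟨ sumL-comm (λ e x → c e * monomial e x * g x) E X ⟩
      sumL (map (λ e → sumL (map (λ x → c e * monomial e x * g x) X)) E)
        ≡⟨ sumL-≡0 term≡0 E ⟩
      0#                                                     ∎
    where
      open ≡-Reasoning
      X = allPoints m
      E = allExponents m
      g = monomialℕ ns
      term≡0 : ∀ e → sumL (map (λ x → c e * monomial e x * g x) X) ≡ 0#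
      term≡0 e with c e ≟ 0#
      ... | yes ce≡0 = sumL-≡0 (λ x → x≡0⇒x*y≡0 _ (x≡0⇒x*y≡0 _ ce≡0)) X
      ... | no ce≢0 = begin
          sumL (map (λ x → c e * monomial e x * g x) X)    ≡⟨ sumL-cong (λ x → *-assoc _ _ _) X ⟩
          sumL (map (λ x → c e * (monomial e x * g x)) X)  ≡⟨ sumL-*ˡ (c e) (λ x → monomial e x * g x) X ⟩
          c e * sumPoints m (λ x → monomial e x * g x)
            ≡⟨ cong (c e *_) (sumPoints-monomial-*-monomialℕ≡0 e ns
                 (ℕₚ.≤-<-trans (ℕₚ.+-monoˡ-≤ (Vec.sum ns) (deg≤r e ce≢0)) bound)) ⟩
          c e * 0#                                         ≡⟨ zeroʳ _ ⟩
          0#                                               ∎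

  monomialℕ-replicate-0 : ∀ {m} (x : Point m) → monomialℕ (Vec.replicate m 0) x ≡ 1#
  monomialℕ-replicate-0 [] = refl
  monomialℕ-replicate-0 (x ∷ xs) = trans (*-identityˡ _) (monomialℕ-replicate-0 xs)

  sum-replicate-0 : ∀ m → Vec.sum (Vec.replicate m 0) ≡ 0
  sum-replicate-0 zero = refl
  sum-replicate-0 (suc m) = sum-replicate-0 m

  coordinateExponent : ∀ {m} → Fin m → Vec ℕ m
  coordinateExponent Fin.zero = 1 ∷ Vec.replicate _ 0
  coordinateExponent (Fin.suc j) = 0 ∷ coordinateExponent j

  monomialℕ-coordinateExponent : ∀ {m} (j : Fin m) x → monomialℕ (coordinateExponent j) x ≡ Vec.lookup x j
  monomialℕ-coordinateExponent Fin.zero (x ∷ xs) =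
    trans (cong₂ _*_ (*-identityʳ x) (monomialℕ-replicate-0 xs)) (*-identityʳ x)
  monomialℕ-coordinateExponent (Fin.suc j) (x ∷ xs) = trans (*-identityˡ _) (monomialℕ-coordinateExponent j xs)

  sum-coordinateExponent : ∀ {m} (j : Fin m) → Vec.sum (coordinateExponent j) ≡ 1
  sum-coordinateExponent {suc m} Fin.zero = cong suc (sum-replicate-0 m)
  sum-coordinateExponent (Fin.suc j) = sum-coordinateExponent j

  sumPoints≡0 : ∀ {m r} {f : B m} → InRM r m f → r < m ℕ.* (q ℕ.∸ 1) → sumPoints m f ≡ 0#
  sumPoints≡0 {m} {r} {f} f∈RM r<m[q-1] = begin
      sumPoints m f                                          ≡⟨ sumL-cong (λ x → sym (*-identityʳ (f x))) (allPoints m) ⟩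
      sumPoints m (λ x → f x * 1#)                           ≡⟨ sumL-cong (λ x → cong (f x *_) (sym (monomialℕ-replicate-0 x))) (allPoints m) ⟩
      sumPoints m (λ x → f x * monomialℕ (Vec.replicate m 0) x)
        ≡⟨ sumPoints-*-monomialℕ≡0 f∈RM (Vec.replicate m 0)
             (subst (_< m ℕ.* (q ℕ.∸ 1)) (sym (trans (cong (r ℕ.+_) (sum-replicate-0 m)) (ℕₚ.+-identityʳ r))) r<m[q-1]) ⟩
      0#                                                     ∎
    where open ≡-Reasoning

  sumPoints-*-lookup≡0 : ∀ {m r} {f : B m} → InRM r m f → suc r < m ℕ.* (q ℕ.∸ 1) →
    ∀ j → sumPoints m (λ x → f x * Vec.lookup x j) ≡ 0#
  sumPoints-*-lookup≡0 {m} {r} {f} f∈RM r+1<m[q-1] j = begin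
      sumPoints m (λ x → f x * Vec.lookup x j)
        ≡⟨ sumL-cong (λ x → cong (f x *_) (sym (monomialℕ-coordinateExponent j x))) (allPoints m) ⟩
      sumPoints m (λ x → f x * monomialℕ (coordinateExponent j) x)
        ≡⟨ sumPoints-*-monomialℕ≡0 f∈RM (coordinateExponent j)
             (subst (_< m ℕ.* (q ℕ.∸ 1)) (sym (trans (cong (r ℕ.+_) (sum-coordinateExponent j)) (ℕₚ.+-comm r 1))) r+1<m[q-1]) ⟩
      0#                                                     ∎
    where open ≡-Reasoning

module Planes {q : ℕ} (F : FiniteField q) where
  open FieldProperties F

  Coords : ℕ → Set
  Coords m = Fin m → Carrier

  module _ {m : ℕ} where
    Independent : Coords m → Coords m → Set
    Independent u v = ∀ a b → (∀ k → a * u k + b * v k ≡ 0#) → a ≡ 0# × b ≡ 0#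

    InSpan : Coords m → Coords m → Coords m → Set
    InSpan u v w = ∃[ s ] ∃[ t ] (∀ k → w k ≡ s * u k + t * v k)

    SpanningPair : Coords m → Coords m → Set
    SpanningPair w w′ = ∃[ u ] ∃[ v ] Independent u v × InSpan u v w × InSpan u v w′

    -- Multiplying the relations at i and j by v j, v i (resp. u j, u i) isolates a (resp. b) times the minor.
    minor≢⇒independent : ∀ {u v} i j → u i * v j ≢ u j * v i → Independent u v
    minor≢⇒independent {u} {v} i j minor≢ a b rel = a≡0 , b≡0
      where
        open ≡-Reasoning
        a≡0 : a ≡ 0#
        a≡0 with a ≟ 0#
        ... | yes a≡0 = a≡0
        ... | no a≢0 = ⊥-elim (minor≢ (*-cancelˡ-nonzero a a≢0 (+-cancelʳ (b * (v i * v j)) _ _ (begin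
            a * (u i * v j) + b * (v i * v j)  ≡⟨ solve 5 (λ a b ui vi vj → a :* (ui :* vj) :+ b :* (vi :* vj) := (a :* ui :+ b :* vi) :* vj) refl a b (u i) (v i) (v j) ⟩
            (a * u i + b * v i) * v j          ≡⟨ x≡0⇒x*y≡0 _ (rel i) ⟩
            0#                                 ≡⟨ sym (x≡0⇒x*y≡0 _ (rel j)) ⟩
            (a * u j + b * v j) * v i          ≡⟨ solve 5 (λ a b uj vi vj → (a :* uj :+ b :* vj) :* vi := a :* (uj :* vi) :+ b :* (vi :* vj)) refl a b (u j) (v i) (v j) ⟩
            a * (u j * v i) + b * (v i * v j)  ∎))))
        b≡0 : b ≡ 0#
        b≡0 with b ≟ 0#
        ... | yes b≡0 = b≡0
        ... | no b≢0 = ⊥-elim (minor≢ (sym (*-cancelˡ-nonzero b b≢0 (+-cancelʳ (a * (u i * u j)) _ _ (begin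
            b * (u j * v i) + a * (u i * u j)  ≡⟨ solve 5 (λ a b ui vi uj → b :* (uj :* vi) :+ a :* (ui :* uj) := (a :* ui :+ b :* vi) :* uj) refl a b (u i) (v i) (u j) ⟩
            (a * u i + b * v i) * u j          ≡⟨ x≡0⇒x*y≡0 _ (rel i) ⟩
            0#                                 ≡⟨ sym (x≡0⇒x*y≡0 _ (rel j)) ⟩
            (a * u j + b * v j) * u i          ≡⟨ solve 5 (λ a b uj vj ui → (a :* uj :+ b :* vj) :* ui := b :* (ui :* vj) :+ a :* (ui :* uj)) refl a b (u j) (v j) (u i) ⟩
            b * (u i * v j) + a * (u i * u j)  ∎)))))

    InSpan-linear : ∀ {u v w w′} → InSpan u v w → InSpan u v w′ → ∀ a b → InSpan u v (λ k → a * w k + b * w′ k)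
    InSpan-linear {u} {v} {w} {w′} (s , t , w≡) (s′ , t′ , w′≡) a b = a * s + b * s′ , a * t + b * t′ , λ k → begin
        a * w k + b * w′ k                                  ≡⟨ cong₂ (λ y z → a * y + b * z) (w≡ k) (w′≡ k) ⟩
        a * (s * u k + t * v k) + b * (s′ * u k + t′ * v k)
          ≡⟨ solve 8 (λ a b s t s′ t′ x y → a :* (s :* x :+ t :* y) :+ b :* (s′ :* x :+ t′ :* y) := (a :* s :+ b :* s′) :* x :+ (a :* t :+ b :* t′) :* y)
               refl a b s t s′ t′ (u k) (v k) ⟩
        (a * s + b * s′) * u k + (a * t + b * t′) * v k     ∎
      where open ≡-Reasoning

    InSpan-left : ∀ u v → InSpan u v u
    InSpan-left u v = 1# , 0# , λ k → sym (trans (cong₂ _+_ (*-identityˡ _) (zeroˡ _)) (+-identityʳ _))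

    InSpan-right : ∀ u v → InSpan u v v
    InSpan-right u v = 0# , 1# , λ k → sym (trans (cong₂ _+_ (zeroˡ _) (*-identityˡ _)) (+-identityˡ _))

    InSpan-zero : ∀ u v {w} → (∀ k → w k ≡ 0#) → InSpan u v w
    InSpan-zero u v w≡0 = 0# , 0# , λ k → trans (w≡0 k) (sym (trans (cong₂ _+_ (zeroˡ _) (zeroˡ _)) (+-identityʳ 0#)))

    unitVector : Fin m → Coords m
    unitVector j k with k Fin.≟ j
    ... | yes _ = 1#
    ... | no _ = 0#

    unitVector-≡ : ∀ j → unitVector j j ≡ 1#
    unitVector-≡ j with j Fin.≟ j
    ... | yes _ = refl
    ... | no j≢j = ⊥-elim (j≢j refl)

    unitVector-≢ : ∀ {j k} → k ≢ j → unitVector j k ≡ 0#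
    unitVector-≢ {j} {k} k≢j with k Fin.≟ j
    ... | yes k≡j = ⊥-elim (k≢j k≡j)
    ... | no _ = refl

    independent-unitVector : ∀ {z i j} → z i ≢ 0# → i ≢ j → Independent z (unitVector j)
    independent-unitVector {z} {i} {j} zi≢0 i≢j = minor≢⇒independent i j λ minor≡ → zi≢0 (begin
        z i                              ≡⟨ sym (*-identityʳ _) ⟩
        z i * 1#                         ≡⟨ cong (z i *_) (sym (unitVector-≡ j)) ⟩
        z i * unitVector j j             ≡⟨ minor≡ ⟩
        z j * unitVector j i             ≡⟨ cong (z j *_) (unitVector-≢ i≢j) ⟩
        z j * 0#                         ≡⟨ zeroʳ _ ⟩
        0#                               ∎)
      where open ≡-Reasoning

    proportional∈span : ∀ {z y i} v → z i ≢ 0# → (∀ k → z i * y k ≡ z k * y i) → InSpan z v y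
    proportional∈span {z} {y} {i} v zi≢0 proportional with inverse (z i) zi≢0
    ... | ζ , ziζ≡1 = y i * ζ , 0# , λ k → begin
        y k                      ≡⟨ sym (*-identityˡ _) ⟩
        1# * y k                 ≡⟨ cong (_* y k) (sym ziζ≡1) ⟩
        z i * ζ * y k            ≡⟨ solve 3 (λ a b c → a :* b :* c := b :* (a :* c)) refl (z i) ζ (y k) ⟩
        ζ * (z i * y k)          ≡⟨ cong (ζ *_) (proportional k) ⟩
        ζ * (z k * y i)          ≡⟨ solve 3 (λ a b c → b :* (a :* c) := c :* b :* a) refl (z k) ζ (y i) ⟩
        y i * ζ * z k            ≡⟨ sym (+-identityʳ _) ⟩
        y i * ζ * z k + 0#       ≡⟨ cong (_ +_) (sym (zeroˡ _)) ⟩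
        y i * ζ * z k + 0# * v k ∎
      where open ≡-Reasoning

  module _ {n : ℕ} where
    private
      m = suc (suc n)

    anotherIndex : Fin m → Fin m
    anotherIndex Fin.zero = Fin.suc Fin.zero
    anotherIndex (Fin.suc _) = Fin.zero

    anotherIndex-≢ : ∀ i → i ≢ anotherIndex i
    anotherIndex-≢ Fin.zero ()
    anotherIndex-≢ (Fin.suc _) ()

    spanningPair-nonzero : ∀ {z : Coords m} {i} → z i ≢ 0# → ∀ y → SpanningPair z y
    spanningPair-nonzero {z} {i} zi≢0 y with any? (λ k → ¬? ((z i * y k) ≟ (z k * y i)))
    ... | yes (k , minor≢) = z , y , minor≢⇒independent i k minor≢ , InSpan-left z y , InSpan-right z y
    ... | no no-minor≢ = z , unitVector j , independent-unitVector zi≢0 (anotherIndex-≢ i) ,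
                         InSpan-left z (unitVector j) , proportional∈span (unitVector j) zi≢0 proportional
      where
        j = anotherIndex i
        proportional : ∀ k → z i * y k ≡ z k * y i
        proportional k = decidable-stable (_ ≟ _) (λ minor≢ → no-minor≢ (k , minor≢))

    swapSpanningPair : ∀ {w w′ : Coords m} → SpanningPair w w′ → SpanningPair w′ w
    swapSpanningPair (u , v , independent , w∈ , w′∈) = u , v , independent , w′∈ , w∈

    spanningPair : ∀ (w w′ : Coords m) → SpanningPair w w′
    spanningPair w w′ with any? (λ k → ¬? (w k ≟ 0#)) | any? (λ k → ¬? (w′ k ≟ 0#))
    ... | yes (i , wi≢0) | _ = spanningPair-nonzero wi≢0 w′
    ... | no _ | yes (i , w′i≢0) = swapSpanningPair (spanningPair-nonzero w′i≢0 w)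
    ... | no w≡0 | no w′≡0 =
      e₀ , e₁ , independent-unitVector {i = Fin.zero} (λ e₀₀≡0 → 0≢1 (trans (sym e₀₀≡0) (unitVector-≡ {m} Fin.zero))) (λ ()) ,
      InSpan-zero e₀ e₁ (zero-everywhere w≡0) , InSpan-zero e₀ e₁ (zero-everywhere w′≡0)
      where
        e₀ = unitVector Fin.zero
        e₁ = unitVector (Fin.suc Fin.zero)
        zero-everywhere : ∀ {v : Coords m} → ¬ (∃[ k ] v k ≢ 0#) → ∀ k → v k ≡ 0#
        zero-everywhere no-nonzero k = decidable-stable (_ ≟ _) (λ vk≢0 → no-nonzero (k , vk≢0))

  difference : ∀ {m} → Point m → Point m → Coords m
  difference x p k = Vec.lookup x k + - Vec.lookup p k

  InAffineSpan : ∀ {m} (P₁ P₂ P₃ x : Point m) → Set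
  InAffineSpan P₁ P₂ P₃ x = InSpan (difference P₂ P₁) (difference P₃ P₁) (difference x P₁)

  InSpan-resp : ∀ {m} {u v w w′ : Coords m} → (∀ k → w k ≡ w′ k) → InSpan u v w′ → InSpan u v w
  InSpan-resp w≗w′ (s , t , w′≡) = s , t , λ k → trans (w≗w′ k) (w′≡ k)

  lookup-⊕-⊙-tabulate : ∀ {m} s t (u v : Coords m) k →
    Vec.lookup ((s ⊙ Vec.tabulate u) ⊕ (t ⊙ Vec.tabulate v)) k ≡ s * u k + t * v k
  lookup-⊕-⊙-tabulate s t u v k = trans (lookup-zipWith _+_ k (s ⊙ Vec.tabulate u) (t ⊙ Vec.tabulate v))
    (cong₂ _+_ (trans (lookup-map k (s *_) (Vec.tabulate u)) (cong (s *_) (lookup∘tabulate u k)))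
               (trans (lookup-map k (t *_) (Vec.tabulate v)) (cong (t *_) (lookup∘tabulate v k))))

  lookup-extensionality : ∀ {m} {x y : Point m} → (∀ k → Vec.lookup x k ≡ Vec.lookup y k) → x ≡ y
  lookup-extensionality {x = x} {y} x≗y = trans (sym (tabulate∘lookup x)) (trans (tabulate-cong x≗y) (tabulate∘lookup y))

  independent⇒linearlyIndependent₂ : ∀ {m} {u v : Coords m} → Independent u v →
    LinearlyIndependent₂ (Vec.tabulate u) (Vec.tabulate v)
  independent⇒linearlyIndependent₂ {u = u} {v} independent a b combination≡0 = independent a b λ k → begin
      a * u k + b * v k                                              ≡⟨ sym (lookup-⊕-⊙-tabulate a b u v k) ⟩
      Vec.lookup ((a ⊙ Vec.tabulate u) ⊕ (b ⊙ Vec.tabulate v)) k     ≡⟨ cong (λ w → Vec.lookup w k) combination≡0 ⟩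
      Vec.lookup zeroV k                                             ≡⟨ lookup-replicate k 0# ⟩
      0#                                                             ∎
    where open ≡-Reasoning

  inSpan⇒inPlane : ∀ {m} {u v : Coords m} {p x} → InSpan u v (difference x p) →
    InPlane p (Vec.tabulate u) (Vec.tabulate v) x
  inSpan⇒inPlane {u = u} {v} {p} {x} (s , t , difference≡) = s , t , lookup-extensionality λ k → begin
      Vec.lookup x k                                        ≡⟨ sym (trans (sym (+-assoc _ _ _)) (x+y-x≡y _ _)) ⟩
      Vec.lookup p k + difference x p k                     ≡⟨ cong (Vec.lookup p k +_) (difference≡ k) ⟩
      Vec.lookup p k + (s * u k + t * v k)
        ≡⟨ cong (Vec.lookup p k +_) (sym (lookup-⊕-⊙-tabulate s t u v k)) ⟩
      Vec.lookup p k + Vec.lookup ((s ⊙ Vec.tabulate u) ⊕ (t ⊙ Vec.tabulate v)) k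
        ≡⟨ sym (lookup-zipWith _+_ k p _) ⟩
      Vec.lookup (p ⊕ ((s ⊙ Vec.tabulate u) ⊕ (t ⊙ Vec.tabulate v))) k ∎
    where open ≡-Reasoning

  affineSpan⊆plane : ∀ {n} (P₁ P₂ P₃ : Point (suc (suc n))) →
    ∃[ u ] ∃[ v ] LinearlyIndependent₂ u v × (∀ x → InAffineSpan P₁ P₂ P₃ x → InPlane P₁ u v x)
  affineSpan⊆plane P₁ P₂ P₃ with spanningPair (difference P₂ P₁) (difference P₃ P₁)
  ... | u , v , independent , d₂∈ , d₃∈ =
    Vec.tabulate u , Vec.tabulate v , independent⇒linearlyIndependent₂ independent ,
    λ { x (a , b , difference≡) → inSpan⇒inPlane (InSpan-resp difference≡ (InSpan-linear d₂∈ d₃∈ a b)) }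

  affineRelation : ∀ {l₁ l₂ l₃ l₄ p₁ p₂ p₃ p₄ μ} → l₄ * μ ≡ 1# → l₁ + (l₂ + (l₃ + l₄)) ≡ 0# →
    l₁ * p₁ + (l₂ * p₂ + (l₃ * p₃ + l₄ * p₄)) ≡ 0# →
    p₄ + - p₁ ≡ μ * - l₂ * (p₂ + - p₁) + μ * - l₃ * (p₃ + - p₁)
  affineRelation {l₁} {l₂} {l₃} {l₄} {p₁} {p₂} {p₃} {p₄} {μ} l₄μ≡1 ∑l≡0 ∑lp≡0 = begin
      d₄                                  ≡⟨ sym (*-identityˡ d₄) ⟩
      1# * d₄                             ≡⟨ cong (_* d₄) (sym l₄μ≡1) ⟩
      l₄ * μ * d₄                         ≡⟨ solve 3 (λ l μ d → l :* μ :* d := μ :* (l :* d)) refl l₄ μ d₄ ⟩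
      μ * (l₄ * d₄)                       ≡⟨ cong (μ *_) (+-inverseʳ-unique (l₂ * d₂ + l₃ * d₃) (l₄ * d₄) ∑ld≡0) ⟩
      μ * - (l₂ * d₂ + l₃ * d₃)           ≡⟨ cong (μ *_) (sym (-‿+-comm _ _)) ⟩
      μ * (- (l₂ * d₂) + - (l₃ * d₃))     ≡⟨ cong (μ *_) (cong₂ _+_ (-‿distribˡ-* l₂ d₂) (-‿distribˡ-* l₃ d₃)) ⟩
      μ * (- l₂ * d₂ + - l₃ * d₃)         ≡⟨ solve 5 (λ μ a b x y → μ :* (a :* x :+ b :* y) := μ :* a :* x :+ μ :* b :* y) refl μ (- l₂) (- l₃) d₂ d₃ ⟩
      μ * - l₂ * d₂ + μ * - l₃ * d₃       ∎
    where
      open ≡-Reasoning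
      d₂ = p₂ + - p₁
      d₃ = p₃ + - p₁
      d₄ = p₄ + - p₁
      -- The relations are invariant under translation, so they hold for the differences pᵢ - p₁.
      ∑ld≡0 : l₂ * d₂ + l₃ * d₃ + l₄ * d₄ ≡ 0#
      ∑ld≡0 = begin
          l₂ * d₂ + l₃ * d₃ + l₄ * d₄                                   ≡⟨ sym (+-identityʳ _) ⟩
          l₂ * d₂ + l₃ * d₃ + l₄ * d₄ + 0#                              ≡⟨ cong (l₂ * d₂ + l₃ * d₃ + l₄ * d₄ +_) (sym (trans (cong (l₁ *_) (-‿inverseʳ p₁)) (zeroʳ l₁))) ⟩
          l₂ * d₂ + l₃ * d₃ + l₄ * d₄ + l₁ * (p₁ + - p₁)
            ≡⟨ solve 9 (λ l₁ l₂ l₃ l₄ p₁ p₂ p₃ p₄ n →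
                 l₂ :* (p₂ :+ n) :+ l₃ :* (p₃ :+ n) :+ l₄ :* (p₄ :+ n) :+ l₁ :* (p₁ :+ n) :=
                 (l₁ :* p₁ :+ (l₂ :* p₂ :+ (l₃ :* p₃ :+ l₄ :* p₄))) :+ (l₁ :+ (l₂ :+ (l₃ :+ l₄))) :* n)
                 refl l₁ l₂ l₃ l₄ p₁ p₂ p₃ p₄ (- p₁) ⟩
          (l₁ * p₁ + (l₂ * p₂ + (l₃ * p₃ + l₄ * p₄))) + (l₁ + (l₂ + (l₃ + l₄))) * - p₁
            ≡⟨ cong₂ _+_ ∑lp≡0 (x≡0⇒x*y≡0 _ ∑l≡0) ⟩
          0# + 0#                                                       ≡⟨ +-identityʳ 0# ⟩
          0#                                                            ∎

  affineDependence⇒inAffineSpan : ∀ {m} {l₁ l₂ l₃ l₄} (P₁ P₂ P₃ P₄ : Point m) → l₄ ≢ 0# →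
    l₁ + (l₂ + (l₃ + l₄)) ≡ 0# →
    (∀ k → l₁ * Vec.lookup P₁ k + (l₂ * Vec.lookup P₂ k + (l₃ * Vec.lookup P₃ k + l₄ * Vec.lookup P₄ k)) ≡ 0#) →
    InAffineSpan P₁ P₂ P₃ P₄
  affineDependence⇒inAffineSpan {l₂ = l₂} {l₃} {l₄} P₁ P₂ P₃ P₄ l₄≢0 ∑l≡0 ∑lP≡0 with inverse l₄ l₄≢0
  ... | μ , l₄μ≡1 = μ * - l₂ , μ * - l₃ , λ k → affineRelation l₄μ≡1 ∑l≡0 (∑lP≡0 k)

  InAffineSpan-first : ∀ {m} (P₁ P₂ P₃ : Point m) → InAffineSpan P₁ P₂ P₃ P₁
  InAffineSpan-first P₁ P₂ P₃ = InSpan-zero _ _ (λ k → -‿inverseʳ (Vec.lookup P₁ k))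

  InAffineSpan-second : ∀ {m} (P₁ P₂ P₃ : Point m) → InAffineSpan P₁ P₂ P₃ P₂
  InAffineSpan-second P₁ P₂ P₃ = InSpan-left _ _

  InAffineSpan-third : ∀ {m} (P₁ P₂ P₃ : Point m) → InAffineSpan P₁ P₂ P₃ P₃
  InAffineSpan-third P₁ P₂ P₃ = InSpan-right _ _

module Support {q : ℕ} (F : FiniteField q) where
  open FieldProperties F
  open MonomialSums F using (sumPoints)

  support : ∀ {m} → B m → List (Point m)
  support {m} f = filter (λ x → ¬? (f x ≟ 0#)) (allPoints m)

  ∈-elements : ∀ a → a ∈ elements
  ∈-elements a = subst (_∈ elements) (enum-index a) (∈-map⁺ enum (∈-allFin (index a)))

  ∈-allPoints : ∀ {m} (x : Point m) → x ∈ allPoints m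
  ∈-allPoints [] = Any.here refl
  ∈-allPoints {suc m} (a ∷ xs) = ∈-concatMap⁺ (λ b → map (b ∷_) (allPoints m))
    (Any.map (λ { refl → ∈-map⁺ (a ∷_) (∈-allPoints xs) }) (∈-elements a))

  ∈-support : ∀ {m} {f : B m} {x} → InSupport f x → x ∈ support f
  ∈-support {x = x} fx≢0 = ∈-filter⁺ (λ x → ¬? (_ ≟ 0#)) (∈-allPoints x) fx≢0

  support-nonzero : ∀ {m} (f : B m) → All (InSupport f) (support f)
  support-nonzero {m} f = all-filter (λ x → ¬? (f x ≟ 0#)) (allPoints m)

  sumL-filter : ∀ {A : Set} {P : A → Set} (P? : ∀ a → Dec (P a)) (h : A → Carrier) →
    (∀ a → ¬ P a → h a ≡ 0#) → ∀ xs → sumL (map h xs) ≡ sumL (map h (filter P? xs))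
  sumL-filter P? h h≡0 [] = refl
  sumL-filter P? h h≡0 (x ∷ xs) with P? x
  ... | yes _ = cong (h x +_) (sumL-filter P? h h≡0 xs)
  ... | no ¬Px = trans (cong₂ _+_ (h≡0 x ¬Px) refl) (trans (+-identityˡ _) (sumL-filter P? h h≡0 xs))

  sumPoints-support : ∀ {m} (f : B m) (h : Point m → Carrier) → (∀ x → f x ≡ 0# → h x ≡ 0#) →
    sumPoints m h ≡ sumL (map h (support f))
  sumPoints-support {m} f h h≡0 = sumL-filter (λ x → ¬? (f x ≟ 0#)) h
    (λ x ¬fx≢0 → h≡0 x (decidable-stable (f x ≟ 0#) ¬fx≢0)) (allPoints m)

module Coplanarity {q : ℕ} (F : FiniteField q) {n : ℕ} where
  open FieldProperties F
  open MonomialSums F using (sumPoints)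
  open Planes F
  open Support F

  private
    m = suc (suc n)

  supportInAffinePlane : ∀ {f : B m} {Ps} P₁ P₂ P₃ → support f ≡ Ps → All (InAffineSpan P₁ P₂ P₃) Ps →
    SupportInAffinePlane f
  supportInAffinePlane P₁ P₂ P₃ support≡Ps Ps⊆span with affineSpan⊆plane P₁ P₂ P₃
  ... | u , v , independent , span⊆plane = P₁ , u , v , independent , λ x fx≢0 →
    span⊆plane x (All.lookup Ps⊆span (subst (x ∈_) support≡Ps (∈-support fx≢0)))

  weight≡3⇒supportInAffinePlane : (f : B m) → weight f ≡ 3 → SupportInAffinePlane f
  weight≡3⇒supportInAffinePlane f weight≡3 with support f in support≡ | weight≡3
  ... | P₁ ∷ P₂ ∷ P₃ ∷ [] | refl = supportInAffinePlane P₁ P₂ P₃ support≡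
    (InAffineSpan-first P₁ P₂ P₃ ∷ InAffineSpan-second P₁ P₂ P₃ ∷ InAffineSpan-third P₁ P₂ P₃ ∷ [])

  weight≡4⇒supportInAffinePlane : (f : B m) → sumPoints m f ≡ 0# →
    (∀ k → sumPoints m (λ x → f x * Vec.lookup x k) ≡ 0#) → weight f ≡ 4 → SupportInAffinePlane f
  weight≡4⇒supportInAffinePlane f ∑f≡0 ∑fx≡0 weight≡4 with support f in support≡ | weight≡4
  ... | P₁ ∷ P₂ ∷ P₃ ∷ P₄ ∷ [] | refl = supportInAffinePlane P₁ P₂ P₃ support≡
    (InAffineSpan-first P₁ P₂ P₃ ∷ InAffineSpan-second P₁ P₂ P₃ ∷ InAffineSpan-third P₁ P₂ P₃ ∷
     affineDependence⇒inAffineSpan P₁ P₂ P₃ P₄ fP₄≢0 (sum-over-support f (λ _ fx≡0 → fx≡0) ∑f≡0)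
       (λ k → sum-over-support (λ x → f x * Vec.lookup x k) (λ _ fx≡0 → x≡0⇒x*y≡0 _ fx≡0) (∑fx≡0 k)) ∷ [])
    where
      fP₄≢0 : f P₄ ≢ 0#
      fP₄≢0 with subst (All (InSupport f)) support≡ (support-nonzero f)
      ... | _ ∷ _ ∷ _ ∷ fP₄≢0 ∷ [] = fP₄≢0
      sum-over-support : ∀ h → (∀ x → f x ≡ 0# → h x ≡ 0#) → sumPoints m h ≡ 0# →
        h P₁ + (h P₂ + (h P₃ + h P₄)) ≡ 0#
      sum-over-support h h≡0 ∑h≡0 = begin
          h P₁ + (h P₂ + (h P₃ + h P₄))               ≡⟨ cong (λ y → h P₁ + (h P₂ + (h P₃ + y))) (sym (+-identityʳ _)) ⟩
          sumL (map h (P₁ ∷ P₂ ∷ P₃ ∷ P₄ ∷ []))       ≡⟨ cong (sumL ∘ map h) (sym support≡) ⟩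
          sumL (map h (support f))                    ≡⟨ sym (sumPoints-support f h h≡0) ⟩
          sumPoints m h                               ≡⟨ ∑h≡0 ⟩
          0#                                          ∎
        where open ≡-Reasoning

open import Data.Nat using (ℕ; _≤_; _∸_; _+_; _*_)
open import Data.Sum using (_⊎_; inj₁; inj₂)
open import Data.Product using (_×_)
open import Relation.Binary.PropositionalEquality using (_≡_)

-- The hypothesis that q is a prime power is implied by the field structure, and three points
-- always lie in a plane: the degree bound matters only for weight 4.
proposition2p2 : ∀ {q : ℕ} (F : FiniteField q) (m : ℕ) → IsPrimePower q → 3 ≤ q → 2 ≤ m →
    (f : FiniteField.B F m) →
    (FiniteField.InRM F ((m ∸ 1) * (q ∸ 1) + (q ∸ 3)) m f × FiniteField.weight F f ≡ 4)
    ⊎ (FiniteField.InRM F ((m ∸ 1) * (q ∸ 1) + (q ∸ 2)) m f × FiniteField.weight F f ≡ 3) →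
    FiniteField.SupportInAffinePlane F f
proposition2p2 {suc (suc (suc k))} F (suc (suc n)) _ (s≤s (s≤s (s≤s _))) (s≤s (s≤s _)) f (inj₁ (f∈RM , weight≡4)) =
  weight≡4⇒supportInAffinePlane f
    (sumPoints≡0 f∈RM (ℕₚ.<-trans (ℕₚ.n<1+n _) degree+1<m[q-1]))
    (sumPoints-*-lookup≡0 f∈RM degree+1<m[q-1])
    weight≡4
  where
    open MonomialSums F
    open Coplanarity F
    degree+1<m[q-1] : suc (suc n * suc (suc k) + k) < suc (suc n) * suc (suc k)
    degree+1<m[q-1] = ℕₚ.≤-reflexive (cong (λ d → suc (suc d)) (ℕₚ.+-comm (suc n * suc (suc k)) k))
proposition2p2 {suc (suc (suc _))} F (suc (suc _)) _ (s≤s (s≤s (s≤s _))) (s≤s (s≤s _)) f (inj₂ (_ , weight≡3)) =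
  Coplanarity.weight≡3⇒supportInAffinePlane F f weight≡3
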